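{- For $x \in \mathbb{C}$ and $n\in\mathbb{N}_0$, $$\sum_{k=1}^n k^2 H_k^{(2)}(x) = \frac{x(x+1)(2x+1) + n(n+1)(2n+1)}{6} H_n^{(2)}(x) - \frac{6x^2 + 6x + 1}{6} H_n(x) + \frac{(4x+2-n)n}{6}.$$
   Context: For $x\in\mathbb{C}$, $l,n\in\mathbb{N}_0$, $H_0^{(l)}(x)=0$ and $H_n^{(l)}(x)=\sum_{k=1}^n \frac{1}{(x+k)^l}$ for $n\ge 1$ (defined whenever $x$ is not one of $-1,\dots,-n$); $H_n(x)=H_n^{(1)}(x)$. -}

module Defs where

open import Level using (suc; _⊔_)
open import Data.Nat using (ℕ; zero) renaming (suc to sucℕ)
open import Relation.Nullary using (¬_)
open import Algebra.Bundles using (CommutativeRing)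

-- A field: a commutative ring with 0 ≉ 1 and a (total) inverse operation
-- that is a genuine multiplicative inverse on every nonzero element
-- (its value at 0 is irrelevant and never used by the statements below).
record Field c ℓ : Set (suc (c ⊔ ℓ)) where
  field
    commutativeRing : CommutativeRing c ℓ
  open CommutativeRing commutativeRing public
  field
    _⁻¹       : Carrier → Carrier
    ⁻¹-inverse : ∀ x → ¬ (x ≈ 0#) → x * (x ⁻¹) ≈ 1#
    0≉1       : ¬ (0# ≈ 1#)

  infix 8 _⁻¹

  ι : ℕ → Carrier
  ι zero      = 0#
  ι (sucℕ n)  = 1# + ι n

  _^_ : Carrier → ℕ → Carrier
  x ^ zero      = 1#
  x ^ (sucℕ l)  = x * (x ^ l)

  sum1 : ℕ → (ℕ → Carrier) → Carrier
  sum1 zero     f = 0#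
  sum1 (sucℕ n) f = sum1 n f + f (sucℕ n)

  H⁽_⁾ : ℕ → ℕ → Carrier → Carrier
  H⁽ l ⁾ n x = sum1 n (λ k → ((x + ι k) ^ l) ⁻¹)

  H : ℕ → Carrier → Carrier
  H n x = H⁽ 1 ⁾ n x

  CharZero : Set ℓ
  CharZero = ∀ k → ¬ (ι (sucℕ k) ≈ 0#)

module Submission where

-- The proof is a telescoping induction on n.  Writing R(n) for the
-- right-hand side, R(0) = 0 and the whole theorem reduces to the increment
--   R(n) + N² H_N^{(2)}(x) = R(N),   N = n + 1, a = x + N.
-- Since H_N^{(2)} = H_n^{(2)} + 1/a² and H_N = H_n + 1/a, the increment is a
-- rational identity in x and n.  Using P(k) = k(k+1)(2k+1), for which
-- P(N) − P(n) = 6N², it reduces to the polynomial identity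
--   P(x) + P(N) − 6N² = (6x²+6x+1)·a − (4x+1−2n)·a²,
-- divided by a² (this is where 1/a and 1/a² are used as true inverses).

open import Defs
open import Level using (Level)
open import Data.Nat as ℕ using (ℕ; zero; suc; _≤_; _<_; s≤s; z≤n)
import Data.Nat.Properties as ℕP
open import Data.Integer as ℤ using (ℤ; +_; -[1+_]; _⊖_)
import Data.Integer.Properties as ℤP
open import Data.Maybe using (Maybe; just; nothing)
open import Relation.Nullary using (¬_; yes; no)
import Relation.Binary.PropositionalEquality as ≡
open import Algebra.Bundles using (CommutativeRing)
open import Algebra.Solver.Ring.AlmostCommutativeRing
  using (fromCommutativeRing; _-Raw-AlmostCommutative⟶_)

module IntegerCoefficients {c ℓ : Level} (R : CommutativeRing c ℓ) where
  open CommutativeRing R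
  open import Relation.Binary.Reasoning.Setoid setoid
  open import Algebra.Properties.Ring ring using (-‿distribˡ-*; -‿distribʳ-*; -‿involutive; -0#≈0#)
  open import Algebra.Properties.AbelianGroup +-abelianGroup using (⁻¹-∙-comm)
  open import Algebra.Properties.CommutativeSemigroup +-commutativeSemigroup using (interchange)
  open import Algebra.Properties.Semiring.Mult.TCOptimised semiring using (_×_; 1+×; ×-homo-+; ×1-homo-*)

  -- The canonical map ℤ → R.  The optimised multiple `n × 1#` sends 1 to 1#
  -- itself, so that the solver's constant 1 is literally 1#.
  ⟦_⟧ℤ : ℤ → Carrier
  ⟦ + n ⟧ℤ      = n × 1#
  ⟦ -[1+ n ] ⟧ℤ = - (suc n × 1#)

  ⊖-homo : ∀ m n → ⟦ m ⊖ n ⟧ℤ ≈ m × 1# - n × 1#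
  ⊖-homo m       zero    = sym (trans (+-congˡ -0#≈0#) (+-identityʳ _))
  ⊖-homo zero    (suc n) = sym (+-identityˡ _)
  ⊖-homo (suc m) (suc n) = begin
    ⟦ suc m ⊖ suc n ⟧ℤ              ≡⟨ ≡.cong ⟦_⟧ℤ (ℤP.[1+m]⊖[1+n]≡m⊖n m n) ⟩
    ⟦ m ⊖ n ⟧ℤ                      ≈⟨ ⊖-homo m n ⟩
    m × 1# - n × 1#                 ≈⟨ +-identityˡ _ ⟨
    0# + (m × 1# - n × 1#)          ≈⟨ +-congʳ (-‿inverseʳ 1#) ⟨
    (1# - 1#) + (m × 1# - n × 1#)   ≈⟨ interchange _ _ _ _ ⟩
    (1# + m × 1#) + (- 1# - n × 1#) ≈⟨ +-cong (1+× m 1#) (trans (-‿cong (1+× n 1#)) (sym (⁻¹-∙-comm _ _))) ⟨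
    suc m × 1# - suc n × 1#         ∎

  +-homo : ∀ i j → ⟦ i ℤ.+ j ⟧ℤ ≈ ⟦ i ⟧ℤ + ⟦ j ⟧ℤ
  +-homo (+ m)      (+ n)      = ×-homo-+ 1# m n
  +-homo (+ m)      -[1+ n ]   = ⊖-homo m (suc n)
  +-homo -[1+ m ]   (+ n)      = trans (⊖-homo n (suc m)) (+-comm _ _)
  +-homo -[1+ m ]   -[1+ n ]   = begin
    - (suc (suc (m ℕ.+ n)) × 1#)     ≡⟨ ≡.cong (λ k → - (suc k × 1#)) (≡.sym (ℕP.+-suc m n)) ⟩
    - ((suc m ℕ.+ suc n) × 1#)       ≈⟨ -‿cong (×-homo-+ 1# (suc m) (suc n)) ⟩
    - (suc m × 1# + suc n × 1#)      ≈⟨ ⁻¹-∙-comm _ _ ⟨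
    - (suc m × 1#) + - (suc n × 1#)  ∎

  -‿homo : ∀ i → ⟦ ℤ.- i ⟧ℤ ≈ - ⟦ i ⟧ℤ
  -‿homo (+ zero)  = sym -0#≈0#
  -‿homo (+ suc n) = refl
  -‿homo -[1+ n ]  = sym (-‿involutive _)

  *-homo⁺ : ∀ m j → ⟦ + m ℤ.* j ⟧ℤ ≈ ⟦ + m ⟧ℤ * ⟦ j ⟧ℤ
  *-homo⁺ m (+ n)    = trans (reflexive (≡.cong ⟦_⟧ℤ (≡.sym (ℤP.pos-* m n)))) (×1-homo-* m n)
  *-homo⁺ m -[1+ n ] = begin
    ⟦ + m ℤ.* -[1+ n ] ⟧ℤ         ≡⟨ ≡.cong ⟦_⟧ℤ (≡.sym (ℤP.neg-distribʳ-* (+ m) (+ suc n))) ⟩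
    ⟦ ℤ.- (+ m ℤ.* + suc n) ⟧ℤ    ≈⟨ -‿homo (+ m ℤ.* + suc n) ⟩
    - ⟦ + m ℤ.* + suc n ⟧ℤ        ≈⟨ -‿cong (*-homo⁺ m (+ suc n)) ⟩
    - (m × 1# * (suc n × 1#))     ≈⟨ -‿distribʳ-* _ _ ⟩
    m × 1# * - (suc n × 1#)       ∎

  *-homo : ∀ i j → ⟦ i ℤ.* j ⟧ℤ ≈ ⟦ i ⟧ℤ * ⟦ j ⟧ℤ
  *-homo (+ m)    j = *-homo⁺ m j
  *-homo -[1+ m ] j = begin
    ⟦ -[1+ m ] ℤ.* j ⟧ℤ          ≡⟨ ≡.cong ⟦_⟧ℤ (≡.sym (ℤP.neg-distribˡ-* (+ suc m) j)) ⟩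
    ⟦ ℤ.- (+ suc m ℤ.* j) ⟧ℤ     ≈⟨ -‿homo (+ suc m ℤ.* j) ⟩
    - ⟦ + suc m ℤ.* j ⟧ℤ         ≈⟨ -‿cong (*-homo⁺ (suc m) j) ⟩
    - (suc m × 1# * ⟦ j ⟧ℤ)      ≈⟨ -‿distribˡ-* _ _ ⟩
    - (suc m × 1#) * ⟦ j ⟧ℤ      ∎

  ℤ⟶R : ℤ.+-*-rawRing -Raw-AlmostCommutative⟶ fromCommutativeRing R
  ℤ⟶R = record
    { ⟦_⟧ = ⟦_⟧ℤ ; +-homo = +-homo ; *-homo = *-homo ; -‿homo = -‿homo
    ; 0-homo = refl ; 1-homo = refl }

  ≟-coefficient : ∀ i j → Maybe (⟦ i ⟧ℤ ≈ ⟦ j ⟧ℤ)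
  ≟-coefficient i j with i ℤ.≟ j
  ... | yes ≡.refl = just refl
  ... | no _       = nothing

  open import Algebra.Solver.Ring ℤ.+-*-rawRing (fromCommutativeRing R) ℤ⟶R ≟-coefficient public

  -- The numeral k in the solver's syntax as 1 + (1 + ⋯ + 0), which evaluates
  -- to exactly the term that the numeral `ι k` of a field unfolds to.
  num : ∀ {n} → ℕ → Polynomial n
  num zero    = con (+ 0)
  num (suc k) = con (+ 1) :+ num k

module SumFormula {c ℓ : Level} (F : Field c ℓ) where
  open Field F
  open IntegerCoefficients commutativeRing using (Polynomial; solve; _:=_; con; num; _:+_; _:-_; _:*_; _:^_)
  open import Relation.Binary.Reasoning.Setoid setoid

  telescope : (f s : ℕ → Carrier) (n : ℕ) → s 0 ≈ 0# →
              (∀ k → k < n → s k + f (suc k) ≈ s (suc k)) → sum1 n f ≈ s n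
  telescope f s zero    s₀≈0 step = sym s₀≈0
  telescope f s (suc n) s₀≈0 step =
    trans (+-congʳ (telescope f s n s₀≈0 (λ k k<n → step k (ℕP.m<n⇒m<1+n k<n))))
          (step n (ℕP.n<1+n n))

  *-nonzero : ∀ {a b} → ¬ (a ≈ 0#) → ¬ (b ≈ 0#) → ¬ (a * b ≈ 0#)
  *-nonzero {a} {b} a≉0 b≉0 ab≈0 = b≉0 (begin
    b                 ≈⟨ *-identityˡ b ⟨
    1# * b            ≈⟨ *-congʳ (trans (*-comm _ _) (⁻¹-inverse a a≉0)) ⟨
    (a ⁻¹ * a) * b    ≈⟨ *-assoc _ _ _ ⟩
    a ⁻¹ * (a * b)    ≈⟨ *-congˡ ab≈0 ⟩
    a ⁻¹ * 0#         ≈⟨ zeroʳ _ ⟩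
    0#                ∎)

  ^-nonzero : ∀ {a} → ¬ (a ≈ 0#) → ∀ l → ¬ (a ^ l ≈ 0#)
  ^-nonzero a≉0 zero    1≈0 = 0≉1 (sym 1≈0)
  ^-nonzero a≉0 (suc l)     = *-nonzero a≉0 (^-nonzero a≉0 l)

  ^-inverse : ∀ {a} → ¬ (a ≈ 0#) → ∀ l → a ^ l * (a ^ l) ⁻¹ ≈ 1#
  ^-inverse a≉0 l = ⁻¹-inverse _ (^-nonzero a≉0 l)

  square-inverse : ∀ {a v w} → a * v ≈ 1# → a ^ 2 * w ≈ 1# → a * w ≈ v
  square-inverse {a} {v} {w} av≈1 a²w≈1 = begin
    a * w              ≈⟨ *-identityʳ _ ⟨
    a * w * 1#         ≈⟨ *-congˡ av≈1 ⟨
    a * w * (a * v)    ≈⟨ solve 3 (λ a v w → a :* w :* (a :* v) := a :^ 2 :* w :* v) refl a v w ⟩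
    a ^ 2 * w * v      ≈⟨ *-congʳ a²w≈1 ⟩
    1# * v             ≈⟨ *-identityˡ v ⟩
    v                  ∎

  -- Dividing an identity c₀ = c₁a − c₂a² by a², given inverses v of a and
  -- w of a²: c₀/a² = c₁/a − c₂.
  divide-by-square : ∀ {a v w} → a * v ≈ 1# → a ^ 2 * w ≈ 1# →
                     ∀ {c₀ c₁ c₂} → c₀ ≈ c₁ * a - c₂ * a ^ 2 → c₀ * w - c₁ * v + c₂ ≈ 0#
  divide-by-square {a} {v} {w} av≈1 a²w≈1 {c₀} {c₁} {c₂} c₀≈ = begin
    c₀ * w - c₁ * v + c₂
      ≈⟨ +-congʳ (+-congʳ (*-congʳ c₀≈)) ⟩
    (c₁ * a - c₂ * a ^ 2) * w - c₁ * v + c₂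
      ≈⟨ solve 5 (λ a v w c₁ c₂ →
              (c₁ :* a :- c₂ :* a :^ 2) :* w :- c₁ :* v :+ c₂
                := c₁ :* (a :* w :- v) :- c₂ :* (a :^ 2 :* w :- con (+ 1)))
           refl a v w c₁ c₂ ⟩
    c₁ * (a * w - v) - c₂ * (a ^ 2 * w - 1#)
      ≈⟨ +-cong (*-congˡ (+-congʳ (square-inverse av≈1 a²w≈1))) (-‿cong (*-congˡ (+-congʳ a²w≈1))) ⟩
    c₁ * (v - v) - c₂ * (1# - 1#)
      ≈⟨ solve 3 (λ v c₁ c₂ → c₁ :* (v :- v) :- c₂ :* (con (+ 1) :- con (+ 1)) := con (+ 0)) refl v c₁ c₂ ⟩
    0#  ∎

  -- The closed form is built from P(k) = k(k+1)(2k+1), with Σ_{k≤n} k² = P(n)/6,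
  -- and from Q(x) = 6x² + 6x + 1.
  P : Carrier → Carrier
  P k = k * (k + 1#) * (ι 2 * k + 1#)

  Q : Carrier → Carrier
  Q x = ι 6 * (x ^ 2) + ι 6 * x + 1#

  closedForm′ : (x m h g u : Carrier) → Carrier
  closedForm′ x m h g u = ((P x + P m) * u) * h - (Q x * u) * g + ((ι 4 * x + ι 2 - m) * m) * u

  closedForm : Carrier → ℕ → Carrier
  closedForm x n = closedForm′ x (ι n) (H⁽ 2 ⁾ n x) (H n x) ((ι 6) ⁻¹)

  Pₚ : ∀ {k} → Polynomial k → Polynomial k
  Pₚ k = k :* (k :+ con (+ 1)) :* (num 2 :* k :+ con (+ 1))

  Qₚ : ∀ {k} → Polynomial k → Polynomial k
  Qₚ x = num 6 :* (x :^ 2) :+ num 6 :* x :+ con (+ 1)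

  closedFormₚ : ∀ {k} → (x m h g u : Polynomial k) → Polynomial k
  closedFormₚ x m h g u =
    ((Pₚ x :+ Pₚ m) :* u) :* h :- (Qₚ x :* u) :* g :+ ((num 4 :* x :+ num 2 :- m) :* m) :* u

  closedForm-zero : ∀ x → closedForm x 0 ≈ 0#
  closedForm-zero x = solve 2 (λ x u → closedFormₚ x (con (+ 0)) (con (+ 0)) (con (+ 0)) u := con (+ 0))
                              refl x ((ι 6) ⁻¹)

  numerator-identity : ∀ x m →
    P x + P (1# + m) - ι 6 * (1# + m) ^ 2
      ≈ Q x * (x + (1# + m)) - (ι 4 * x + 1# - ι 2 * m) * (x + (1# + m)) ^ 2
  numerator-identity = solve 2 (λ x m →
    Pₚ x :+ Pₚ (con (+ 1) :+ m) :- num 6 :* (con (+ 1) :+ m) :^ 2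
      := Qₚ x :* (x :+ (con (+ 1) :+ m)) :- (num 4 :* x :+ con (+ 1) :- num 2 :* m) :* (x :+ (con (+ 1) :+ m)) :^ 2)
    refl

  -- Passing from m to N = m + 1 while h and g gain the terms w and v: since
  -- P(N) − P(m) = 6N², the change is N²(h + w) times 6u, plus u times a
  -- remainder that involves only w, v and the numerator identity.
  step-identity : ∀ x m h g u v w →
    closedForm′ x (1# + m) (h + w) (g + v) u
      ≈ closedForm′ x m h g u + (ι 6 * u) * ((1# + m) ^ 2 * (h + w))
        + u * ((P x + P (1# + m) - ι 6 * (1# + m) ^ 2) * w - Q x * v + (ι 4 * x + 1# - ι 2 * m))
  step-identity = solve 7 (λ x m h g u v w → let N = con (+ 1) :+ m in
    closedFormₚ x N (h :+ w) (g :+ v) u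
      := closedFormₚ x m h g u :+ (num 6 :* u) :* (N :^ 2 :* (h :+ w))
         :+ u :* ((Pₚ x :+ Pₚ N :- num 6 :* N :^ 2) :* w :- Qₚ x :* v :+ (num 4 :* x :+ con (+ 1) :- num 2 :* m)))
    refl

  increment : CharZero → ∀ x n → ¬ (x + ι (suc n) ≈ 0#) →
              closedForm x n + (ι (suc n) ^ 2) * H⁽ 2 ⁾ (suc n) x ≈ closedForm x (suc n)
  increment charZero x n a≉0 = begin
    closedForm x n + N ^ 2 * (h + w)
      ≈⟨ solve 3 (λ r s u → r :+ s := r :+ con (+ 1) :* s :+ u :* con (+ 0)) refl _ _ u ⟩
    closedForm x n + 1# * (N ^ 2 * (h + w)) + u * 0#
      ≈⟨ +-cong (+-congˡ (*-congʳ 6u≈1)) (*-congˡ remainder≈0) ⟨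
    closedForm x n + (ι 6 * u) * (N ^ 2 * (h + w)) + u * remainder
      ≈⟨ step-identity x (ι n) h (H n x) u v w ⟨
    closedForm x (suc n) ∎
    where
    N a h u v w remainder : Carrier
    N = ι (suc n)
    a = x + N
    h = H⁽ 2 ⁾ n x
    u = (ι 6) ⁻¹
    v = (a ^ 1) ⁻¹
    w = (a ^ 2) ⁻¹
    remainder = (P x + P N - ι 6 * N ^ 2) * w - Q x * v + (ι 4 * x + 1# - ι 2 * ι n)

    6u≈1 : ι 6 * u ≈ 1#
    6u≈1 = ⁻¹-inverse (ι 6) (charZero 5)

    av≈1 : a * v ≈ 1#
    av≈1 = trans (*-congʳ (sym (*-identityʳ a))) (^-inverse a≉0 1)

    remainder≈0 : remainder ≈ 0#
    remainder≈0 = divide-by-square av≈1 (^-inverse a≉0 2) (numerator-identity x (ι n))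

proposition9 : ∀ {c ℓ : Level} (F : Field c ℓ) → let open Field F in
    CharZero → ∀ (x : Carrier) (n : ℕ) →
    (∀ k → 1 ≤ k → k ≤ n → ¬ ((x + ι k) ≈ 0#)) →
    sum1 n (λ k → (ι k ^ 2) * H⁽ 2 ⁾ k x)
      ≈ ((x * (x + 1#) * (ι 2 * x + 1#) + ι n * (ι n + 1#) * (ι 2 * ι n + 1#)) * (ι 6) ⁻¹) * H⁽ 2 ⁾ n x
        - ((ι 6 * (x ^ 2) + ι 6 * x + 1#) * (ι 6) ⁻¹) * H n x
        + ((ι 4 * x + ι 2 - ι n) * ι n) * (ι 6) ⁻¹
proposition9 F charZero x n x+k≉0 =
  telescope (λ k → (ι k ^ 2) * H⁽ 2 ⁾ k x) (closedForm x) n (closedForm-zero x)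
    (λ k k<n → increment charZero x k (x+k≉0 (suc k) (s≤s z≤n) k<n))
  where open Field F
        open SumFormula F
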